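{- Let $d\ge3$, $h\ge1$ and let $\ell$ be a leaf of $\mathcal{T}(d,h)$. Then the order of $\bar{\mathbf{x}}_\ell$ in the sandpile group $G(d,h)$ divides $$(d-1)^h\,\mathrm{lcm}\{d\,\theta(d,h+1),\theta(d,h),\theta(d,h-1),\dots,\theta(d,2)\},$$ where $\theta(d,m)=\frac{(d-1)^m-1}{d-2}$.
   Context: Let $\mathcal{T}(d,h)$ be the ball of radius $h$ about a root vertex $0$ in the infinite $d$-regular tree (root has $d$ children, vertices at depth $1,\dots,h-1$ have $d-1$ children, depth-$h$ vertices are leaves). Let $V$ be its vertex set, $p(i)$ the parent of $i\neq 0$, $C_i$ the children of $i$, $\{\mathbf{x}_i\}$ the standard basis of $\mathbb{Z}^V$, and $\delta_i = d\mathbf{x}_i - \mathbf{x}_{p(i)} - \sum_{j\in C_i}\mathbf{x}_j$ (omit $\mathbf{x}_{p(i)}$ for $i=0$; empty sum for leaves). The sandpile group is $G(d,h)=\mathbb{Z}^V/\sum_{i\in V}\mathbb{Z}\delta_i$, and $\bar{\mathbf{v}}$ denotes the image of $\mathbf{v}\in\mathbb{Z}^V$. -}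

module Defs where

open import Data.Nat as ℕ using (ℕ; zero; suc; _∸_; _^_; _<_)
open import Data.Nat.DivMod using (_/_)
open import Data.Nat.LCM using (lcm)
open import Data.Integer as ℤ using (ℤ; +_; _-_)
open import Data.Fin as Fin using (Fin)
open import Data.List using (List; []; _∷_; length; foldr; applyUpTo)
import Data.List.Properties as LP
import Data.Maybe.Properties as MP
open import Data.Maybe using (Maybe; just; nothing)
open import Relation.Nullary using (Dec; yes; no)
open import Relation.Binary.PropositionalEquality using (_≡_; refl; cong₂)

-- A non-root vertex is encoded by the path from the
-- root: the first step  a : Fin d  (the root has d children) followed by
-- the later steps  w : List (Fin (d ∸ 1))  (other vertices have d-1 children),
-- stored most-recent-step first.
data V (d h : ℕ) : Set where
  root : V d h
  node : (a : Fin d) (w : List (Fin (d ∸ 1))) → .(length w < h) → V d h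

depth : ∀ {d h} → V d h → ℕ
depth root = 0
depth (node a w _) = suc (length w)

IsLeaf : ∀ {d h} → V d h → Set
IsLeaf {d} {h} v = depth v ≡ h

_≟V_ : ∀ {d h} (u v : V d h) → Dec (u ≡ v)
root ≟V root = yes refl
root ≟V node _ _ _ = no λ ()
node _ _ _ ≟V root = no λ ()
node a w _ ≟V node b u _ with a Fin.≟ b | LP.≡-dec Fin._≟_ w u
... | yes refl | yes refl = yes refl
... | no a≢b | _ = no λ { refl → a≢b refl }
... | yes _ | no w≢u = no λ { refl → w≢u refl }

parent : ∀ {d h} → V d h → Maybe (V d h)
parent root = nothing
parent (node a [] _) = just root
parent {h = h} (node a (b ∷ w) p) = just (node a w (lem p))
  where
  lem : ∀ {n} → suc n < h → n < h
  lem q = ℕ.<-trans (ℕ.s≤s ℕ.≤-refl) q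
    where import Data.Nat.Properties as ℕ

ind : ∀ {a} {P : Set a} → Dec P → ℤ
ind (yes _) = + 1
ind (no _)  = + 0

𝐱 : ∀ {d h} → V d h → V d h → ℤ
𝐱 i v = ind (v ≟V i)

-- δ_i = d x_i - x_{p(i)} - Σ_{j ∈ C_i} x_j, as a function V → ℤ.
-- (x is a child of i  iff  p(x) = i.)
δ : ∀ {d h} → V d h → V d h → ℤ
δ {d} i x = (+ d) ℤ.* ind (x ≟V i)
          - ind (MP.≡-dec _≟V_ (parent i) (just x))
          - ind (MP.≡-dec _≟V_ (parent x) (just i))

-- The subgroup  Σ_i ℤ δ_i  of ℤ^V (vectors as functions, pointwise equality):
-- the smallest set containing 0 and closed under adding/subtracting any δ_i.
data InLattice {d h : ℕ} : (V d h → ℤ) → Set where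
  zero : ∀ {v} → (∀ x → v x ≡ + 0) → InLattice v
  plus : ∀ {v w} i → InLattice v → (∀ x → w x ≡ v x ℤ.+ δ i x) → InLattice w
  minus : ∀ {v w} i → InLattice v → (∀ x → w x ≡ v x - δ i x) → InLattice w

-- The order of the class of v in G(d,h) = ℤ^V / Σ ℤ δ_i divides N
-- iff N · v̄ = 0 in G(d,h), i.e. N·v ∈ Σ ℤ δ_i.
OrderDivides : ∀ {d h} → (V d h → ℤ) → ℕ → Set
OrderDivides v N = InLattice (λ x → (+ N) ℤ.* v x)

-- θ(d,m) = ((d-1)^m - 1)/(d-2)  (exact division; only used for d ≥ 3,
-- junk value 0 for d < 3)
θ : ℕ → ℕ → ℕ
θ (suc (suc (suc k))) m = ((suc (suc k)) ^ m ∸ 1) / suc k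
θ _ m = 0

lcmList : List ℕ → ℕ
lcmList = foldr lcm 1

bound : ℕ → ℕ → ℕ
bound d h = (d ∸ 1) ^ h ℕ.* lcmList (d ℕ.* θ d (suc h) ∷ applyUpTo (λ i → θ d (2 ℕ.+ i)) (h ∸ 1))

-- Write c = d − 1 and R m = 1 + c + ⋯ + c^(m−1) for the base-c repunit, so that θ(d,m) = R m,
-- R 1 = 1, R 2 = d and R (m+1) = 1 + c R m.  Modulo the relations δ_i one shows, from the
-- leaves upwards, that R(n+2) x_u ≡ R(n+1) x_{p(u)} for every vertex u at height n: at a leaf
-- this is δ_u itself, and above it is R(n+2) δ_u plus the relations of the c children of u.
-- At the root the same combination gives d c^h x_0 ≡ 0.  Walking back down, consecutive
-- repunits are coprime and both divide the lcm, so the order of x_u divides N / R(n+1) for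
-- the bound N; at a leaf R 1 = 1.
module Submission where

open import Defs
open import Data.Nat as ℕ using (ℕ; zero; suc; _≤_; _<_; _∸_; _^_; s≤s; z≤n)
import Data.Nat.Properties as ℕ
open import Data.Nat.Divisibility
  using (_∣_; divides; 1∣_; ∣-trans; ∣1⇒≡1; ∣m+n∣m⇒∣n; ∣n⇒∣m*n; n∣m*n; m∣m*n;
         *-cancelˡ-∣; *-cancelʳ-∣; *-monoʳ-∣)
open import Data.Nat.GCD using (gcd)
open import Data.Nat.Coprimality using (Coprime; coprime⇒gcd≡1)
open import Data.Nat.LCM using (lcm; m∣lcm[m,n]; n∣lcm[m,n]; lcm-least; gcd*lcm)
open import Data.Nat.DivMod using (_/_; m*n/n≡m)
open import Data.Integer using (ℤ; +_; _+_; _-_; _*_)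
import Data.Integer.Properties as ℤ
import Data.Integer.Tactic.RingSolver as ℤ-Solver
import Data.Nat.Tactic.RingSolver as ℕ-Solver
open import Algebra.Properties.CommutativeMonoid.Sum ℤ.+-0-commutativeMonoid
  using (sum; sum-syntax; sum-remove; sum-cong-≗; sum-replicate-zero)
open import Data.Fin as Fin using (Fin; punchIn)
open import Data.Fin.Properties using (punchInᵢ≢i)
open import Data.List using (List; []; _∷_; length; applyUpTo)
import Data.List.Properties as List
open import Data.List.Relation.Unary.Any using (here; there)
open import Data.List.Membership.Propositional using (_∈_)
open import Data.List.Membership.Propositional.Properties using (∈-applyUpTo⁺)
open import Data.Maybe using (just)
import Data.Maybe.Properties as Maybe
open import Data.Product using (_×_; _,_)
open import Data.Sum using (inj₁; inj₂)
open import Data.Empty using (⊥-elim)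
open import Relation.Nullary using (Dec; yes; no; ¬_)
open import Relation.Nullary.Decidable using (recompute)
open import Relation.Binary.PropositionalEquality

∑-zero : (n : ℕ) (f : Fin n → ℤ) → (∀ i → f i ≡ + 0) → ∑[ i < n ] f i ≡ + 0
∑-zero n f f≗0 = trans (sum-cong-≗ f≗0) (sum-replicate-zero n)

∑-indicator : (n : ℕ) (f : Fin n → ℤ) (i : Fin n) → f i ≡ + 1 → (∀ j → j ≢ i → f j ≡ + 0) →
              ∑[ j < n ] f j ≡ + 1
∑-indicator (suc n) f i fi≡1 f≗0 = begin
  sum f
    ≡⟨ sum-remove f ⟩
  f i + sum (λ j → f (punchIn i j))
    ≡⟨ cong₂ _+_ fi≡1 (∑-zero n _ (λ j → f≗0 _ (punchInᵢ≢i i j))) ⟩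
  + 1 ∎
  where open ≡-Reasoning

∑-affine : (n : ℕ) (a b : ℤ) (f : Fin n → ℤ) →
           ∑[ i < n ] (a * f i - b) ≡ a * (∑[ i < n ] f i) - + n * b
∑-affine zero    a b f = solve a b
  where
  solve : ∀ a b → + 0 ≡ a * + 0 - + 0 * b
  solve = ℤ-Solver.solve-∀
∑-affine (suc n) a b f = begin
  (a * y - b) + ∑[ i < n ] (a * f (Fin.suc i) - b) ≡⟨ cong (_+_ (a * y - b)) (∑-affine n a b _) ⟩
  (a * y - b) + (a * s - + n * b)                  ≡⟨ solve a b y s (+ n) ⟩
  a * (y + s) - (+ 1 + + n) * b                    ∎
  where
  open ≡-Reasoning
  y = f Fin.zero
  s = ∑[ i < n ] f (Fin.suc i)
  solve : ∀ a b y s m → (a * y - b) + (a * s - m * b) ≡ a * (y + s) - (+ 1 + m) * b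
  solve = ℤ-Solver.solve-∀

ind-yes : ∀ {a} {P : Set a} (p : Dec P) → P → ind p ≡ + 1
ind-yes (yes _) _ = refl
ind-yes (no ¬p) p = ⊥-elim (¬p p)

ind-no : ∀ {a} {P : Set a} (p : Dec P) → ¬ P → ind p ≡ + 0
ind-no (yes p) ¬p = ⊥-elim (¬p p)
ind-no (no _)  _  = refl

ind-cong : ∀ {a b} {P : Set a} {Q : Set b} (p : Dec P) (q : Dec Q) → (P → Q) → (Q → P) →
           ind p ≡ ind q
ind-cong (yes _) (yes _) _   _   = refl
ind-cong (no _)  (no _)  _   _   = refl
ind-cong (yes p) (no ¬q) p→q _   = ⊥-elim (¬q (p→q p))
ind-cong (no ¬p) (yes q) _   q→p = ⊥-elim (¬p (q→p q))

module _ {d h : ℕ} where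

  InLattice-cong : {v w : V d h → ℤ} → v ≗ w → InLattice v → InLattice w
  InLattice-cong v≗w (zero v≗0)     = zero (λ x → trans (sym (v≗w x)) (v≗0 x))
  InLattice-cong v≗w (plus i l eq)  = plus i l (λ x → trans (sym (v≗w x)) (eq x))
  InLattice-cong v≗w (minus i l eq) = minus i l (λ x → trans (sym (v≗w x)) (eq x))

  InLattice-+ : {v w : V d h → ℤ} → InLattice v → InLattice w → InLattice (λ x → v x + w x)
  InLattice-+ {v} lv (zero w≗0) =
    InLattice-cong (λ x → sym (trans (cong (_+_ (v x)) (w≗0 x)) (ℤ.+-identityʳ (v x)))) lv
  InLattice-+ {v} lv (plus {w′} i lw eq) = plus i (InLattice-+ lv lw)
    (λ x → trans (cong (_+_ (v x)) (eq x)) (sym (ℤ.+-assoc (v x) (w′ x) _)))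
  InLattice-+ {v} lv (minus {w′} i lw eq) = minus i (InLattice-+ lv lw)
    (λ x → trans (cong (_+_ (v x)) (eq x)) (sym (ℤ.+-assoc (v x) (w′ x) _)))

  InLattice-* : {v : V d h → ℤ} (n : ℕ) → InLattice v → InLattice (λ x → + n * v x)
  InLattice-* {v} zero    l = zero (λ x → ℤ.*-zeroˡ (v x))
  InLattice-* {v} (suc n) l =
    InLattice-cong (λ x → sym (ℤ.suc-* (+ n) (v x))) (InLattice-+ l (InLattice-* n l))

  InLattice-δ : (i : V d h) → InLattice (δ i)
  InLattice-δ i = plus i (zero (λ _ → refl)) (λ x → sym (ℤ.+-identityˡ (δ i x)))

  InLattice-∑ : (n : ℕ) {g : Fin n → V d h → ℤ} → (∀ b → InLattice (g b)) →
                InLattice (λ x → ∑[ b < n ] g b x)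
  InLattice-∑ zero    lg = zero (λ _ → refl)
  InLattice-∑ (suc n) lg = InLattice-+ (lg Fin.zero) (InLattice-∑ n (λ b → lg (Fin.suc b)))

  OrderDivides-∣ : {v : V d h → ℤ} {m n : ℕ} → m ∣ n → OrderDivides v m → OrderDivides v n
  OrderDivides-∣ {v} {m} (divides q refl) l = InLattice-cong
    (λ x → trans (sym (ℤ.*-assoc (+ q) (+ m) (v x))) (cong (_* v x) (sym (ℤ.pos-* q m))))
    (InLattice-* q l)

  OrderDivides-transfer : {v w : V d h → ℤ} (a b q : ℕ) → InLattice (λ x → + a * v x - + b * w x) →
                          OrderDivides w (q ℕ.* b) → OrderDivides v (q ℕ.* a)
  OrderDivides-transfer {v} {w} a b q lvw lw = InLattice-cong eq (InLattice-+ (InLattice-* q lvw) lw)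
    where
    identity : ∀ Q A B X Y → Q * (A * X - B * Y) + (Q * B) * Y ≡ (Q * A) * X
    identity = ℤ-Solver.solve-∀
    eq : ∀ x → + q * (+ a * v x - + b * w x) + + (q ℕ.* b) * w x ≡ + (q ℕ.* a) * v x
    eq x = begin
      + q * (+ a * v x - + b * w x) + + (q ℕ.* b) * w x
        ≡⟨ cong (λ t → + q * (+ a * v x - + b * w x) + t * w x) (ℤ.pos-* q b) ⟩
      + q * (+ a * v x - + b * w x) + (+ q * + b) * w x
        ≡⟨ identity (+ q) (+ a) (+ b) (v x) (w x) ⟩
      (+ q * + a) * v x
        ≡⟨ cong (_* v x) (ℤ.pos-* q a) ⟨
      + (q ℕ.* a) * v x ∎
      where open ≡-Reasoning

module _ {d h : ℕ} where

  parentOf : V d h → V d h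
  parentOf root               = root
  parentOf (node a [] _)      = root
  parentOf (node a (b ∷ w) p) = node a w (ℕ.<-trans (ℕ.n<1+n _) p)

  parent-indicator child-indicator : V d h → V d h → ℤ
  parent-indicator u x = ind (Maybe.≡-dec _≟V_ (parent u) (just x))
  child-indicator  u x = ind (Maybe.≡-dec _≟V_ (parent x) (just u))

  parent-node : ∀ (a : Fin d) w .(p : length w < h) → parent (node a w p) ≡ just (parentOf (node a w p))
  parent-node a []      p = refl
  parent-node a (b ∷ w) p = refl

  parent-indicator-node : ∀ (a : Fin d) w .(p : length w < h) x →
                          parent-indicator (node a w p) x ≡ 𝐱 (parentOf (node a w p)) x
  parent-indicator-node a w p x = ind-cong (Maybe.≡-dec _≟V_ _ _) (x ≟V _)
    (λ e → sym (Maybe.just-injective (trans (sym (parent-node a w p)) e)))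
    (λ { refl → parent-node a w p })

  child-indicator-leaf : ∀ (a : Fin d) w .(p : length w < h) → depth (node a w p) ≡ h →
                         ∀ x → child-indicator (node a w p) x ≡ + 0
  child-indicator-leaf a w p _    root                  = refl
  child-indicator-leaf a w p _    (node a′ [] q)        = refl
  child-indicator-leaf a w p leaf (node a′ (b′ ∷ w′) q) = ind-no (Maybe.≡-dec _≟V_ _ _)
    λ { refl → ℕ.<-irrefl leaf (recompute (suc (length w) ℕ.<? h) q) }

  child-indicator-inner : ∀ (a : Fin d) w .(p : length w < h) (inner : depth (node a w p) < h) →
                          ∀ x → child-indicator (node a w p) x ≡ ∑[ b < d ∸ 1 ] 𝐱 (node a (b ∷ w) inner) x
  child-indicator-inner a w p inner root =
    sym (∑-zero (d ∸ 1) (λ b → 𝐱 (node a (b ∷ w) inner) root) (λ _ → refl))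
  child-indicator-inner a w p inner x@(node a′ [] q) =
    sym (∑-zero (d ∸ 1) (λ b → 𝐱 (node a (b ∷ w) inner) x) (λ b → ind-no (x ≟V _) λ ()))
  child-indicator-inner a w p inner x@(node a′ (b′ ∷ w′) q) =
    by-cases (a′ Fin.≟ a) (List.≡-dec Fin._≟_ w′ w)
    where
    child : Fin (d ∸ 1) → V d h
    child b = node a (b ∷ w) inner
    not-child : ¬ (a′ ≡ a × w′ ≡ w) →
                child-indicator (node a w p) x ≡ ∑[ b < d ∸ 1 ] 𝐱 (child b) x
    not-child ne = trans (ind-no (Maybe.≡-dec _≟V_ _ _) λ { refl → ne (refl , refl) })
      (sym (∑-zero (d ∸ 1) (λ b → 𝐱 (child b) x)
                   (λ b → ind-no (x ≟V child b) λ { refl → ne (refl , refl) })))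
    by-cases : Dec (a′ ≡ a) → Dec (w′ ≡ w) →
               child-indicator (node a w p) x ≡ ∑[ b < d ∸ 1 ] 𝐱 (child b) x
    by-cases (yes refl) (yes refl) = trans (ind-yes (Maybe.≡-dec _≟V_ _ _) refl)
      (sym (∑-indicator (d ∸ 1) (λ b → 𝐱 (child b) x) b′ (ind-yes (x ≟V x) refl)
                        (λ b b≢b′ → ind-no (x ≟V child b) λ { refl → b≢b′ refl })))
    by-cases (no a′≢a) _         = not-child (λ (eq , _) → a′≢a eq)
    by-cases (yes _)   (no w′≢w) = not-child (λ (_ , eq) → w′≢w eq)

  child-indicator-root : (z : 0 < h) → ∀ x → child-indicator root x ≡ ∑[ a < d ] 𝐱 (node a [] z) x
  child-indicator-root z root =
    sym (∑-zero d (λ a → 𝐱 (node a [] z) root) (λ _ → refl))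
  child-indicator-root z x@(node a′ [] q) =
    sym (∑-indicator d (λ a → 𝐱 (node a [] z) x) a′ (ind-yes (x ≟V x) refl)
                     (λ a a≢a′ → ind-no (x ≟V node a [] z) λ { refl → a≢a′ refl }))
  child-indicator-root z x@(node a′ (b′ ∷ w′) q) =
    sym (∑-zero d (λ a → 𝐱 (node a [] z) x) (λ a → ind-no (x ≟V node a [] z) λ ()))

  δ-leaf : ∀ (a : Fin d) w .(p : length w < h) → depth (node a w p) ≡ h →
           ∀ x → δ (node a w p) x ≡ + d * 𝐱 (node a w p) x - 𝐱 (parentOf (node a w p)) x
  δ-leaf a w p leaf x = trans
    (cong₂ (λ P C → + d * 𝐱 (node a w p) x - P - C)
           (parent-indicator-node a w p x) (child-indicator-leaf a w p leaf x))
    (ℤ.+-identityʳ _)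

  δ-inner : ∀ (a : Fin d) w .(p : length w < h) (inner : depth (node a w p) < h) →
            ∀ x → δ (node a w p) x ≡ + d * 𝐱 (node a w p) x - 𝐱 (parentOf (node a w p)) x
                                     - ∑[ b < d ∸ 1 ] 𝐱 (node a (b ∷ w) inner) x
  δ-inner a w p inner x = cong₂ (λ P C → + d * 𝐱 (node a w p) x - P - C)
    (parent-indicator-node a w p x) (child-indicator-inner a w p inner x)

  δ-root : (z : 0 < h) → ∀ x → δ root x ≡ + d * 𝐱 root x - ∑[ a < d ] 𝐱 (node a [] z) x
  δ-root z x = cong₂ _-_ (ℤ.+-identityʳ (+ d * 𝐱 root x)) (child-indicator-root z x)

repunit : ℕ → ℕ → ℕ
repunit c zero    = 0
repunit c (suc m) = suc (c ℕ.* repunit c m)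

repunit-1 : ∀ c → repunit c 1 ≡ 1
repunit-1 c = cong suc (ℕ.*-zeroʳ c)

repunit-2 : ∀ c → repunit c 2 ≡ suc c
repunit-2 c = cong suc (trans (cong (c ℕ.*_) (repunit-1 c)) (ℕ.*-identityʳ c))

repunit-suc-+ : ∀ c m → repunit c (suc m) ≡ repunit c m ℕ.+ c ^ m
repunit-suc-+ c zero    = repunit-1 c
repunit-suc-+ c (suc m) = begin
  suc (c ℕ.* repunit c (suc m))         ≡⟨ cong (λ r → suc (c ℕ.* r)) (repunit-suc-+ c m) ⟩
  suc (c ℕ.* (repunit c m ℕ.+ c ^ m))   ≡⟨ cong suc (ℕ.*-distribˡ-+ c (repunit c m) (c ^ m)) ⟩
  suc (c ℕ.* repunit c m ℕ.+ c ^ suc m) ∎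
  where open ≡-Reasoning

pos-repunit-suc : ∀ c m → + repunit c (suc m) ≡ + 1 + + c * + repunit c m
pos-repunit-suc c m = cong (_+_ (+ 1)) (ℤ.pos-* c (repunit c m))

repunit-geometric : ∀ c m → suc c ^ m ≡ repunit (suc c) m ℕ.* c ℕ.+ 1
repunit-geometric c zero    = refl
repunit-geometric c (suc m) = begin
  suc c ℕ.* suc c ^ m           ≡⟨ cong (suc c ℕ.*_) (repunit-geometric c m) ⟩
  suc c ℕ.* (r ℕ.* c ℕ.+ 1)     ≡⟨ solve c r ⟩
  suc (suc c ℕ.* r) ℕ.* c ℕ.+ 1 ∎
  where
  open ≡-Reasoning
  r = repunit (suc c) m
  solve : ∀ c r → suc c ℕ.* (r ℕ.* c ℕ.+ 1) ≡ suc (suc c ℕ.* r) ℕ.* c ℕ.+ 1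
  solve = ℕ-Solver.solve-∀

θ≡repunit : ∀ k m → θ (3 ℕ.+ k) m ≡ repunit (2 ℕ.+ k) m
θ≡repunit k m = begin
  (suc (suc k) ^ m ∸ 1) / suc k     ≡⟨ cong (λ t → (t ∸ 1) / suc k) (repunit-geometric (suc k) m) ⟩
  (r ℕ.* suc k ℕ.+ 1 ∸ 1) / suc k   ≡⟨ cong (_/ suc k) (ℕ.m+n∸n≡m (r ℕ.* suc k) 1) ⟩
  (r ℕ.* suc k) / suc k             ≡⟨ m*n/n≡m r (suc k) ⟩
  r                                 ∎
  where
  open ≡-Reasoning
  r = repunit (2 ℕ.+ k) m

repunit-coprime : ∀ c m → Coprime (repunit c m) (repunit c (suc m))
repunit-coprime c m {i} (i∣r , i∣r′) =
  ∣1⇒≡1 (∣m+n∣m⇒∣n (subst (i ∣_) (ℕ.+-comm 1 (c ℕ.* repunit c m)) i∣r′) (∣n⇒∣m*n c i∣r))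

module _ {c h : ℕ} where

  child-parent-relation : ∀ n (a : Fin (suc c)) w .(p : length w < h) → depth (node a w p) ℕ.+ n ≡ h →
    InLattice (λ x → + repunit c (2 ℕ.+ n) * 𝐱 (node a w p) x
                     - + repunit c (1 ℕ.+ n) * 𝐱 (parentOf (node a w p)) x)
  child-parent-relation zero a w p e = InLattice-cong leaf-eq (InLattice-δ u)
    where
    u = node a w p
    leaf-eq : ∀ x → δ u x ≡ + repunit c 2 * 𝐱 u x - + repunit c 1 * 𝐱 (parentOf u) x
    leaf-eq x = begin
      δ u x
        ≡⟨ δ-leaf a w p (trans (sym (ℕ.+-identityʳ _)) e) x ⟩
      + suc c * 𝐱 u x - 𝐱 (parentOf u) x
        ≡⟨ cong (λ y → + suc c * 𝐱 u x - y) (ℤ.*-identityˡ _) ⟨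
      + suc c * 𝐱 u x - + 1 * 𝐱 (parentOf u) x
        ≡⟨ cong₂ (λ r₂ r₁ → + r₂ * 𝐱 u x - + r₁ * 𝐱 (parentOf u) x) (repunit-2 c) (repunit-1 c) ⟨
      + repunit c 2 * 𝐱 u x - + repunit c 1 * 𝐱 (parentOf u) x ∎
      where open ≡-Reasoning
  child-parent-relation (suc n) a w p e = InLattice-cong inner-eq
    (InLattice-+ (InLattice-* A (InLattice-δ u))
                 (InLattice-∑ c (λ b → child-parent-relation n a (b ∷ w) inner e′)))
    where
    u = node a w p
    A = repunit c (2 ℕ.+ n)
    B = repunit c (1 ℕ.+ n)
    inner : depth u < h
    inner = subst (depth u <_) e (ℕ.m<m+n (depth u) (s≤s z≤n))
    e′ : suc (depth u) ℕ.+ n ≡ h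
    e′ = trans (sym (ℕ.+-suc (depth u) n)) e
    identity : ∀ {A A′ : ℤ} C B X Y S → A ≡ + 1 + C * B → A′ ≡ + 1 + C * A →
               A * ((+ 1 + C) * X - Y - S) + (A * S - C * (B * X)) ≡ A′ * X - A * Y
    identity C B X Y S refl refl = solve C B X Y S
      where
      solve : ∀ C B X Y S → let A = + 1 + C * B in
              A * ((+ 1 + C) * X - Y - S) + (A * S - C * (B * X)) ≡ (+ 1 + C * A) * X - A * Y
      solve = ℤ-Solver.solve-∀
    inner-eq : ∀ x → + A * δ u x + ∑[ b < c ] (+ A * 𝐱 (node a (b ∷ w) inner) x - + B * 𝐱 u x)
                   ≡ + repunit c (3 ℕ.+ n) * 𝐱 u x - + A * 𝐱 (parentOf u) x
    inner-eq x = begin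
      + A * δ u x + ∑[ b < c ] (+ A * 𝐱 (node a (b ∷ w) inner) x - + B * 𝐱 u x)
        ≡⟨ cong₂ _+_ (cong (+ A *_) (δ-inner a w p inner x))
                     (∑-affine c (+ A) (+ B * 𝐱 u x) (λ b → 𝐱 (node a (b ∷ w) inner) x)) ⟩
      + A * (+ suc c * 𝐱 u x - 𝐱 (parentOf u) x - S) + (+ A * S - + c * (+ B * 𝐱 u x))
        ≡⟨ identity (+ c) (+ B) (𝐱 u x) (𝐱 (parentOf u) x) S
                    (pos-repunit-suc c (1 ℕ.+ n)) (pos-repunit-suc c (2 ℕ.+ n)) ⟩
      + repunit c (3 ℕ.+ n) * 𝐱 u x - + A * 𝐱 (parentOf u) x ∎
      where
      open ≡-Reasoning
      S = ∑[ b < c ] 𝐱 (node a (b ∷ w) inner) x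

root-relation : ∀ c h → OrderDivides {suc c} {suc h} (𝐱 root) (suc c ℕ.* c ^ suc h)
root-relation c h = InLattice-cong root-eq
  (InLattice-+ (InLattice-* A (InLattice-δ root))
               (InLattice-∑ (suc c) (λ a → child-parent-relation h a [] z refl)))
  where
  z : 0 < suc h
  z = s≤s z≤n
  A = repunit c (2 ℕ.+ h)
  B = repunit c (1 ℕ.+ h)
  identity : ∀ {A} D B P X S → A ≡ B + P → A * (D * X - S) + (A * S - D * (B * X)) ≡ (D * P) * X
  identity D B P X S refl = solve D B P X S
    where
    solve : ∀ D B P X S → (B + P) * (D * X - S) + ((B + P) * S - D * (B * X)) ≡ (D * P) * X
    solve = ℤ-Solver.solve-∀
  root-eq : ∀ x → + A * δ root x + ∑[ a < suc c ] (+ A * 𝐱 (node a [] z) x - + B * 𝐱 root x)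
                ≡ + (suc c ℕ.* c ^ suc h) * 𝐱 root x
  root-eq x = begin
    + A * δ root x + ∑[ a < suc c ] (+ A * 𝐱 (node a [] z) x - + B * 𝐱 root x)
      ≡⟨ cong₂ _+_ (cong (+ A *_) (δ-root z x))
                   (∑-affine (suc c) (+ A) (+ B * 𝐱 root x) (λ a → 𝐱 (node a [] z) x)) ⟩
    + A * (+ suc c * 𝐱 root x - S) + (+ A * S - + suc c * (+ B * 𝐱 root x))
      ≡⟨ identity (+ suc c) (+ B) (+ (c ^ suc h)) (𝐱 root x) S
                  (trans (cong +_ (repunit-suc-+ c (suc h))) (ℤ.pos-+ B _)) ⟩
    (+ suc c * + (c ^ suc h)) * 𝐱 root x
      ≡⟨ cong (_* 𝐱 root x) (ℤ.pos-* (suc c) (c ^ suc h)) ⟨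
    + (suc c ℕ.* c ^ suc h) * 𝐱 root x ∎
    where
    open ≡-Reasoning
    S = ∑[ a < suc c ] 𝐱 (node a [] z) x

module _ {c h : ℕ} (N : ℕ)
         (root∣N : suc c ℕ.* c ^ suc h ℕ.* repunit c (2 ℕ.+ h) ∣ N)
         (pair∣N : ∀ n → n < suc h → repunit c (1 ℕ.+ n) ℕ.* repunit c (2 ℕ.+ n) ∣ N) where

  orderDivides-root : ∀ K → N ∣ K ℕ.* repunit c (2 ℕ.+ h) → OrderDivides {suc c} {suc h} (𝐱 root) K
  orderDivides-root K N∣K = OrderDivides-∣ {m = suc c ℕ.* c ^ suc h} {n = K}
    (*-cancelʳ-∣ (repunit c (2 ℕ.+ h)) (∣-trans root∣N N∣K)) (root-relation c h)

  mutual
    orderDivides-node : ∀ n (a : Fin (suc c)) w .(p : length w < suc h) → depth (node a w p) ℕ.+ n ≡ suc h →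
                        ∀ K → N ∣ K ℕ.* repunit c (1 ℕ.+ n) → OrderDivides (𝐱 (node a w p)) K
    orderDivides-node n a w p e K N∣K
      with *-cancelˡ-∣ (repunit c (1 ℕ.+ n)) (∣-trans (pair∣N n n<h) (subst (N ∣_) (ℕ.*-comm K _) N∣K))
      where
      n<h : n < suc h
      n<h = subst (n <_) e (s≤s (ℕ.m≤n+m n (length w)))
    ... | divides q refl = OrderDivides-transfer (repunit c (2 ℕ.+ n)) (repunit c (1 ℕ.+ n)) q
      (child-parent-relation n a w p e)
      (orderDivides-parent n a w p e (q ℕ.* repunit c (1 ℕ.+ n)) (subst (N ∣_) (swap q _ _) N∣K))
      where
      swap : ∀ q a b → (q ℕ.* a) ℕ.* b ≡ (q ℕ.* b) ℕ.* a
      swap = ℕ-Solver.solve-∀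

    orderDivides-parent : ∀ n (a : Fin (suc c)) w .(p : length w < suc h) → depth (node a w p) ℕ.+ n ≡ suc h →
                          ∀ K → N ∣ K ℕ.* repunit c (2 ℕ.+ n) → OrderDivides (𝐱 (parentOf (node a w p))) K
    orderDivides-parent n a []      p refl = orderDivides-root
    orderDivides-parent n a (b ∷ w) p e    =
      orderDivides-node (suc n) a w _ (trans (ℕ.+-suc (suc (length w)) n) e)

∈⇒∣lcmList : ∀ {x} xs → x ∈ xs → x ∣ lcmList xs
∈⇒∣lcmList (x ∷ xs) (here refl)  = m∣lcm[m,n] x (lcmList xs)
∈⇒∣lcmList (y ∷ xs) (there x∈xs) = ∣-trans (∈⇒∣lcmList xs x∈xs) (n∣lcm[m,n] y (lcmList xs))

coprime⇒*∣ : ∀ {m n o} → Coprime m n → m ∣ o → n ∣ o → m ℕ.* n ∣ o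
coprime⇒*∣ {m} {n} {o} cop m∣o n∣o = subst (_∣ o) lcm≡* (lcm-least m∣o n∣o)
  where
  lcm≡* : lcm m n ≡ m ℕ.* n
  lcm≡* = begin
    lcm m n             ≡⟨ ℕ.*-identityˡ (lcm m n) ⟨
    1 ℕ.* lcm m n       ≡⟨ cong (ℕ._* lcm m n) (coprime⇒gcd≡1 cop) ⟨
    gcd m n ℕ.* lcm m n ≡⟨ gcd*lcm m n ⟩
    m ℕ.* n             ∎
    where open ≡-Reasoning

module _ (k h : ℕ) where

  private
    c = 2 ℕ.+ k
    d = 3 ℕ.+ k
    terms = d ℕ.* θ d (2 ℕ.+ h) ∷ applyUpTo (λ i → θ d (2 ℕ.+ i)) h
    L = lcmList terms

  repunit∣lcm : ∀ j → 1 ≤ j → j ≤ 2 ℕ.+ h → repunit c j ∣ L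
  repunit∣lcm (suc zero) _ _ = subst (_∣ L) (sym (repunit-1 c)) (1∣ L)
  repunit∣lcm (suc (suc i)) _ (s≤s (s≤s i≤h)) with ℕ.m≤n⇒m<n∨m≡n i≤h
  ... | inj₁ i<h  = subst (_∣ L) (θ≡repunit k (2 ℕ.+ i))
                          (∈⇒∣lcmList terms (there (∈-applyUpTo⁺ (λ i → θ d (2 ℕ.+ i)) i<h)))
  ... | inj₂ refl = ∣-trans (n∣m*n d) (subst (λ t → d ℕ.* t ∣ L) (θ≡repunit k (2 ℕ.+ i))
                                             (∈⇒∣lcmList terms (here refl)))

  bound-root : d ℕ.* c ^ suc h ℕ.* repunit c (2 ℕ.+ h) ∣ bound d (suc h)
  bound-root = subst (_∣ bound d (suc h)) (reassoc d (c ^ suc h) _) (*-monoʳ-∣ (c ^ suc h)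
    (subst (λ t → d ℕ.* t ∣ L) (θ≡repunit k (2 ℕ.+ h)) (∈⇒∣lcmList terms (here refl))))
    where
    reassoc : ∀ d q r → q ℕ.* (d ℕ.* r) ≡ d ℕ.* q ℕ.* r
    reassoc = ℕ-Solver.solve-∀

  bound-pair : ∀ n → n < suc h → repunit c (1 ℕ.+ n) ℕ.* repunit c (2 ℕ.+ n) ∣ bound d (suc h)
  bound-pair n n<h = ∣n⇒∣m*n (c ^ suc h) (coprime⇒*∣ (repunit-coprime c (1 ℕ.+ n))
    (repunit∣lcm (1 ℕ.+ n) (s≤s z≤n) (ℕ.m≤n⇒m≤1+n n<h))
    (repunit∣lcm (2 ℕ.+ n) (s≤s z≤n) (s≤s n<h)))

lemma7p3 : (d h : ℕ) → 3 ≤ d → 1 ≤ h → (ℓ : V d h) → IsLeaf ℓ →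
    OrderDivides (𝐱 ℓ) (bound d h)
lemma7p3 (suc (suc (suc k))) (suc h) _ _ (node a w p) leaf =
  orderDivides-node N (bound-root k h) (bound-pair k h) 0 a w p (trans (ℕ.+-identityʳ _) leaf)
                    N (m∣m*n (repunit (2 ℕ.+ k) 1))
  where N = bound (3 ℕ.+ k) (suc h)
lemma7p3 (suc (suc (suc k))) (suc h) _ _ root ()
lemma7p3 (suc (suc (suc k))) zero _ () _ _
lemma7p3 (suc (suc zero)) _ (s≤s (s≤s ())) _ _
lemma7p3 (suc zero) _ (s≤s ()) _ _
lemma7p3 zero _ () _ _
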